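{- Let $k\ge 1$, let $f$ be a Dyck word of length $2k$ and let $F=F(f)$ be its Dyck nest, which contains exactly two entries equal to $k$, and these are adjacent. Let $q(F)$ be the string of length $2k+2$ obtained from $F$ by inserting the substring $(k+1)(k+1)$ between the two entries equal to $k$ (so that $q(F)$ contains the substring $k\,(k+1)\,(k+1)\,k$). Then $q(F)$ is a Dyck nest of length $2k+2$ (i.e. $q(F)=F(g)$ for some Dyck word $g$ of length $2k+2$), and the corresponding binary string $q(f)$, obtained from $q(F)$ by replacing the first occurrence of each integer by a 0-bit and the second occurrence by a 1-bit, is a Dyck word of length $2k+2$.
   Context: A Dyck word of length $2k$ is a binary string $f=f_1\cdots f_{2k}$ with exactly $k$ ones such that every prefix of $f$ contains at least as many 0-bits as 1-bits. Its Dyck path is the lattice path from height $0$ obtained by reading $f$ from left to right and replacing each 0-bit by an up-step $(x,y)\to(x+1,y+1)$ and each 1-bit by a down-step $(x,y)\to(x+1,y-1)$. The Dyck nest $F(f)=F_1\cdots F_{2k}$ is the string obtained by assigning the integers $1,2,\ldots,k$ successively to the steps as follows: one processes the horizontal unit layers $[y,y+1]$ for $y=0,1,2,\ldots$ in increasing order, and within each layer one assigns consecutive integers (continuing the count from the previous layers) to the up-steps of that layer from right to left, and likewise to the down-steps of that layer from right to left; $F_i$ is the integer assigned to the $i$-th step. A string is called a Dyck nest of length $2k$ if it equals $F(f)$ for some Dyck word $f$ of length $2k$. Given $F(f)$, the word $f$ is recovered by replacing the first occurrence of each integer by $0$ and the second by $1$. -}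

module Defs where

open import Data.Bool using (Bool; true; false; if_then_else_; _∧_; _∨_; not)
open import Data.Nat using (ℕ; zero; suc; _+_; _*_; _∸_; _≤_; _<ᵇ_; _≡ᵇ_)
open import Data.List using (List; []; _∷_; length; take)
open import Data.Product using (Σ; _×_; _,_; ∃-syntax)
open import Relation.Binary.PropositionalEquality using (_≡_)

-- Bits: false = 0-bit (up-step), true = 1-bit (down-step).

zeros : List Bool → ℕ
zeros [] = 0
zeros (false ∷ w) = suc (zeros w)
zeros (true ∷ w) = zeros w

ones : List Bool → ℕ
ones [] = 0
ones (false ∷ w) = ones w
ones (true ∷ w) = suc (ones w)

DyckWord : ℕ → List Bool → Set
DyckWord k f = (length f ≡ 2 * k) × (ones f ≡ k)
             × (∀ n → ones (take n f) ≤ zeros (take n f))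

-- Each step tagged with its type and the layer [y, y+1] it lies in,
-- starting from height h.  An up-step from height h lies in layer h;
-- a down-step from height h lies in layer h - 1.
layers : ℕ → List Bool → List (Bool × ℕ)
layers h [] = []
layers h (false ∷ w) = (false , h) ∷ layers (suc h) w
layers h (true ∷ w) = (true , h ∸ 1) ∷ layers (h ∸ 1) w

-- number of up-steps lying in layers strictly below y
-- (= the count reached when processing of layer y starts)
countBelow : ℕ → List (Bool × ℕ) → ℕ
countBelow y [] = 0
countBelow y ((b , z) ∷ l) =
  (if not b ∧ (z <ᵇ y) then 1 else 0) + countBelow y l

beq : Bool → Bool → Bool
beq true true = true
beq false false = true
beq _ _ = false

countSame : Bool × ℕ → List (Bool × ℕ) → ℕ
countSame p [] = 0
countSame (b , y) ((c , z) ∷ l) =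
  (if beq b c ∧ (y ≡ᵇ z) then 1 else 0) + countSame (b , y) l

-- labels: a step of type b in layer y receives
--   (count before layer y) + (number of same-type steps of layer y to its right) + 1,
-- i.e. within each layer up-steps are numbered right to left continuing the
-- count of previous layers, and likewise the down-steps.
labels : List (Bool × ℕ) → List (Bool × ℕ) → List ℕ
labels all [] = []
labels all ((b , y) ∷ rest) =
  (countBelow y all + countSame (b , y) rest + 1) ∷ labels all rest

nest : List Bool → List ℕ
nest f = labels (layers 0 f) (layers 0 f)

IsDyckNest : ℕ → List ℕ → Set
IsDyckNest k F = ∃[ g ] (DyckWord k g × nest g ≡ F)

elemᵇ : ℕ → List ℕ → Bool
elemᵇ x [] = false
elemᵇ x (y ∷ ys) = (x ≡ᵇ y) ∨ elemᵇ x ys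

toBitsAux : List ℕ → List ℕ → List Bool
toBitsAux seen [] = []
toBitsAux seen (x ∷ xs) = elemᵇ x seen ∷ toBitsAux (x ∷ seen) xs

toBits : List ℕ → List Bool
toBits = toBitsAux []

{-# OPTIONS --safe #-}
module Submission where

-- Cut f at its first highest peak, f = P 0 1 Q, where the peak lies in the top layer t and P
-- stays strictly below height t + 1.  Every layer of a Dyck path holds equally many up- and
-- down-steps, and the top layer is numbered last, from right to left; so the peak's two steps,
-- the leftmost up- and down-step of the top layer, both get the label k, and every other label
-- is smaller.  Raising the peak, g = P 0 0 1 1 Q, adds one layer holding a single up/down pair,
-- labelled k + 1, and changes no other label, since the labels of a layer only depend on that
-- layer and the layers below it.  Finally toBits inverts nest on Dyck words: the i-th down-step
-- from the right of a layer gets the label of the i-th up-step from the right of that layer,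
-- which lies to its left.

open import Defs
open import Data.Bool using (Bool; true; false; T; if_then_else_; _∧_; _∨_; not)
open import Data.Bool.Properties using (∨-zeroʳ)
open import Data.Empty using (⊥; ⊥-elim)
open import Data.List using (List; []; _∷_; length; take; _++_)
open import Data.List.Membership.Propositional using (_∉_)
open import Data.List.Properties using (++-identityʳ)
open import Data.List.Relation.Unary.All as All using (All; []; _∷_)
open import Data.List.Relation.Unary.Any using (here; there)
open import Data.Nat
  using (ℕ; zero; suc; _+_; _*_; _∸_; _≤_; _<_; _<ᵇ_; _≡ᵇ_; z≤n; s≤s; z<s; _⊔_; _≤′_; ≤′-refl; ≤′-step)
open import Data.Nat.Properties
open import Algebra.Properties.CommutativeSemigroup +-commutativeSemigroup using (interchange)
open import Data.Nat.Tactic.RingSolver using (solve-∀)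
open import Data.Product using (_×_; _,_; ∃-syntax; proj₁; proj₂)
open import Data.Sum using (inj₁; inj₂)
open import Data.Unit using (⊤; tt)
open import Function using (_∘_)
open import Relation.Binary.Definitions using (tri<; tri≈; tri>)
open import Relation.Binary.PropositionalEquality
open import Relation.Nullary using (¬_; yes; no)

Step : Set
Step = Bool × ℕ

𝟙 : Bool → ℕ
𝟙 b = if b then 1 else 0

ups downs : ℕ → List Step → ℕ
ups y = countSame (false , y)
downs y = countSame (true , y)

LayersBelow : ℕ → List Step → Set
LayersBelow M = All (λ s → proj₂ s < M)

T⇒≡true : ∀ {b} → T b → b ≡ true
T⇒≡true {true} _ = refl

¬T⇒≡false : ∀ {b} → ¬ T b → b ≡ false
¬T⇒≡false {false} _ = refl
¬T⇒≡false {true} ¬t = ⊥-elim (¬t tt)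

≡ᵇ-refl : ∀ n → (n ≡ᵇ n) ≡ true
≡ᵇ-refl n = T⇒≡true (≡⇒≡ᵇ n n refl)

≡ᵇ-true⇒≡ : ∀ m n → (m ≡ᵇ n) ≡ true → m ≡ n
≡ᵇ-true⇒≡ m n e = ≡ᵇ⇒≡ m n (subst T (sym e) tt)

≢⇒≡ᵇ-false : ∀ m n → m ≢ n → (m ≡ᵇ n) ≡ false
≢⇒≡ᵇ-false m n m≢n = ¬T⇒≡false (m≢n ∘ ≡ᵇ⇒≡ m n)

≡ᵇ-sym : ∀ m n → (m ≡ᵇ n) ≡ (n ≡ᵇ m)
≡ᵇ-sym zero zero = refl
≡ᵇ-sym zero (suc n) = refl
≡ᵇ-sym (suc m) zero = refl
≡ᵇ-sym (suc m) (suc n) = ≡ᵇ-sym m n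

<⇒<ᵇ-true : ∀ {m n} → m < n → (m <ᵇ n) ≡ true
<⇒<ᵇ-true m<n = T⇒≡true (<⇒<ᵇ m<n)

≮⇒<ᵇ-false : ∀ m n → ¬ m < n → (m <ᵇ n) ≡ false
≮⇒<ᵇ-false m n m≮n = ¬T⇒≡false (m≮n ∘ <ᵇ⇒< m n)

𝟙-<ᵇ-suc : ∀ y h → 𝟙 (y <ᵇ suc h) ≡ 𝟙 (y <ᵇ h) + 𝟙 (y ≡ᵇ h)
𝟙-<ᵇ-suc y h with <-cmp y h
... | tri< y<h _ _
  rewrite <⇒<ᵇ-true (m<n⇒m<1+n y<h) | <⇒<ᵇ-true y<h | ≢⇒≡ᵇ-false y h (<⇒≢ y<h) = refl
... | tri≈ _ refl _
  rewrite <⇒<ᵇ-true (n<1+n y) | ≮⇒<ᵇ-false y y (<-irrefl refl) | ≡ᵇ-refl y = refl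
... | tri> _ _ h<y
  rewrite ≮⇒<ᵇ-false y (suc h) (<⇒≱ h<y ∘ ≤-pred) | ≮⇒<ᵇ-false y h (<-asym h<y)
        | ≢⇒≡ᵇ-false y h (>⇒≢ h<y) = refl

beq-refl : ∀ b → beq b b ≡ true
beq-refl true = refl
beq-refl false = refl

countSame-here : ∀ b y L → countSame (b , y) ((b , y) ∷ L) ≡ suc (countSame (b , y) L)
countSame-here b y L rewrite beq-refl b | ≡ᵇ-refl y = refl

countSame-otherLayer : ∀ b y c z L → y ≢ z → countSame (b , y) ((c , z) ∷ L) ≡ countSame (b , y) L
countSame-otherLayer b y c z L y≢z rewrite ≢⇒≡ᵇ-false y z y≢z with beq b c
... | true = refl
... | false = refl

countSame-≤-∷ : ∀ s s′ L → countSame s L ≤ countSame s (s′ ∷ L)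
countSame-≤-∷ (b , y) (c , z) L = m≤n+m _ (𝟙 (beq b c ∧ (y ≡ᵇ z)))

countSame-++ : ∀ s A B → countSame s (A ++ B) ≡ countSame s A + countSame s B
countSame-++ s [] B = refl
countSame-++ (b , y) ((c , z) ∷ A) B
  rewrite countSame-++ (b , y) A B = sym (+-assoc (𝟙 (beq b c ∧ (y ≡ᵇ z))) _ _)

countSame-suffix : ∀ s A B → countSame s B ≤ countSame s (A ++ B)
countSame-suffix s A B = subst (countSame s B ≤_) (sym (countSame-++ s A B)) (m≤n+m _ _)

countSame-aboveAll : ∀ b y L → LayersBelow y L → countSame (b , y) L ≡ 0
countSame-aboveAll b y [] [] = refl
countSame-aboveAll b y ((c , z) ∷ L) (z<y ∷ L<y)
  rewrite countSame-otherLayer b y c z L (>⇒≢ z<y) = countSame-aboveAll b y L L<y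

countBelow-++ : ∀ y A B → countBelow y (A ++ B) ≡ countBelow y A + countBelow y B
countBelow-++ y [] B = refl
countBelow-++ y ((c , z) ∷ A) B
  rewrite countBelow-++ y A B = sym (+-assoc (𝟙 (not c ∧ (z <ᵇ y))) _ _)

countBelow-suc : ∀ y L → countBelow (suc y) L ≡ countBelow y L + ups y L
countBelow-suc y [] = refl
countBelow-suc y ((true , z) ∷ L) = countBelow-suc y L
countBelow-suc y ((false , z) ∷ L) = begin
  𝟙 (z <ᵇ suc y) + countBelow (suc y) L
    ≡⟨ cong₂ _+_ (𝟙-<ᵇ-suc z y) (countBelow-suc y L) ⟩
  (𝟙 (z <ᵇ y) + 𝟙 (z ≡ᵇ y)) + (countBelow y L + ups y L)
    ≡⟨ cong (λ e → (𝟙 (z <ᵇ y) + 𝟙 e) + (countBelow y L + ups y L)) (≡ᵇ-sym z y) ⟩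
  (𝟙 (z <ᵇ y) + 𝟙 (y ≡ᵇ z)) + (countBelow y L + ups y L)
    ≡⟨ interchange (𝟙 (z <ᵇ y)) _ _ _ ⟩
  (𝟙 (z <ᵇ y) + countBelow y L) + (𝟙 (y ≡ᵇ z) + ups y L) ∎
  where open ≡-Reasoning

countBelow-mono′ : ∀ {y y′} L → y ≤′ y′ → countBelow y L ≤ countBelow y′ L
countBelow-mono′ L ≤′-refl = ≤-refl
countBelow-mono′ {y} {suc y′} L (≤′-step y≤′y′) rewrite countBelow-suc y′ L =
  ≤-trans (countBelow-mono′ L y≤′y′) (m≤m+n _ _)

countBelow-mono : ∀ {y y′} L → y ≤ y′ → countBelow y L ≤ countBelow y′ L
countBelow-mono L = countBelow-mono′ L ∘ ≤⇒≤′

NonNeg : ℕ → List Bool → Set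
NonNeg h [] = ⊤
NonNeg h (false ∷ w) = NonNeg (suc h) w
NonNeg zero (true ∷ w) = ⊥
NonNeg (suc h) (true ∷ w) = NonNeg h w

endHeight : ℕ → List Bool → ℕ
endHeight h [] = h
endHeight h (false ∷ w) = endHeight (suc h) w
endHeight h (true ∷ w) = endHeight (h ∸ 1) w

maxHeight : ℕ → List Bool → ℕ
maxHeight h [] = h
maxHeight h (false ∷ w) = maxHeight (suc h) w
maxHeight h (true ∷ w) = h ⊔ maxHeight (h ∸ 1) w

start≤maxHeight : ∀ h w → h ≤ maxHeight h w
start≤maxHeight h [] = ≤-refl
start≤maxHeight h (false ∷ w) = ≤-trans (n≤1+n h) (start≤maxHeight (suc h) w)
start≤maxHeight h (true ∷ w) = m≤m⊔n h _

maxHeight-suffix : ∀ h A B → maxHeight (endHeight h A) B ≤ maxHeight h (A ++ B)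
maxHeight-suffix h [] B = ≤-refl
maxHeight-suffix h (false ∷ A) B = maxHeight-suffix (suc h) A B
maxHeight-suffix h (true ∷ A) B = ≤-trans (maxHeight-suffix (h ∸ 1) A B) (m≤n⊔m h _)

layers-++ : ∀ h A B → layers h (A ++ B) ≡ layers h A ++ layers (endHeight h A) B
layers-++ h [] B = refl
layers-++ h (false ∷ A) B = cong (_ ∷_) (layers-++ (suc h) A B)
layers-++ h (true ∷ A) B = cong (_ ∷_) (layers-++ (h ∸ 1) A B)

NonNeg-++⁻ : ∀ h A B → NonNeg h (A ++ B) → NonNeg h A × NonNeg (endHeight h A) B
NonNeg-++⁻ h [] B nn = tt , nn
NonNeg-++⁻ h (false ∷ A) B nn = NonNeg-++⁻ (suc h) A B nn
NonNeg-++⁻ (suc h) (true ∷ A) B nn = NonNeg-++⁻ h A B nn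

layers-below : ∀ h w M → NonNeg h w → maxHeight h w ≤ M → LayersBelow M (layers h w)
layers-below h [] M nn ≤M = []
layers-below h (false ∷ w) M nn ≤M =
  ≤-trans (start≤maxHeight (suc h) w) ≤M ∷ layers-below (suc h) w M nn ≤M
layers-below (suc h) (true ∷ w) M nn ≤M =
  ≤-trans (m≤m⊔n (suc h) (maxHeight h w)) ≤M ∷
  layers-below h w M nn (≤-trans (m≤n⊔m (suc h) _) ≤M)

endHeight+ones : ∀ h w → NonNeg h w → endHeight h w + ones w ≡ h + zeros w
endHeight+ones h [] nn = refl
endHeight+ones h (false ∷ w) nn = trans (endHeight+ones (suc h) w nn) (sym (+-suc h (zeros w)))
endHeight+ones (suc h) (true ∷ w) nn =
  trans (+-suc (endHeight h w) (ones w)) (cong suc (endHeight+ones h w nn))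

zeros+ones≡length : ∀ w → zeros w + ones w ≡ length w
zeros+ones≡length [] = refl
zeros+ones≡length (false ∷ w) = cong suc (zeros+ones≡length w)
zeros+ones≡length (true ∷ w) = trans (+-suc (zeros w) (ones w)) (cong suc (zeros+ones≡length w))

PrefixBalanced : ℕ → List Bool → Set
PrefixBalanced h w = ∀ n → ones (take n w) ≤ zeros (take n w) + h

PrefixBalanced⇒NonNeg : ∀ h w → PrefixBalanced h w → NonNeg h w
PrefixBalanced⇒NonNeg h [] pb = tt
PrefixBalanced⇒NonNeg h (false ∷ w) pb = PrefixBalanced⇒NonNeg (suc h) w λ n →
  subst (ones (take n w) ≤_) (sym (+-suc (zeros (take n w)) h)) (pb (suc n))
PrefixBalanced⇒NonNeg zero (true ∷ w) pb with pb 1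
... | ()
PrefixBalanced⇒NonNeg (suc h) (true ∷ w) pb = PrefixBalanced⇒NonNeg h w λ n →
  ≤-pred (subst (suc (ones (take n w)) ≤_) (+-suc (zeros (take n w)) h) (pb (suc n)))

NonNeg⇒PrefixBalanced : ∀ h w → NonNeg h w → PrefixBalanced h w
NonNeg⇒PrefixBalanced h w nn zero = z≤n
NonNeg⇒PrefixBalanced h [] nn (suc n) = z≤n
NonNeg⇒PrefixBalanced h (false ∷ w) nn (suc n) =
  subst (ones (take n w) ≤_) (+-suc (zeros (take n w)) h) (NonNeg⇒PrefixBalanced (suc h) w nn n)
NonNeg⇒PrefixBalanced (suc h) (true ∷ w) nn (suc n) =
  subst (suc (ones (take n w)) ≤_) (sym (+-suc (zeros (take n w)) h))
    (s≤s (NonNeg⇒PrefixBalanced h w nn n))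

module _ {k : ℕ} {f : List Bool} (dw : DyckWord k f) where

  DyckWord⇒NonNeg : NonNeg 0 f
  DyckWord⇒NonNeg = PrefixBalanced⇒NonNeg 0 f λ n →
    subst (ones (take n f) ≤_) (sym (+-identityʳ _)) (proj₂ (proj₂ dw) n)

  DyckWord⇒zeros≡k : zeros f ≡ k
  DyckWord⇒zeros≡k = +-cancelʳ-≡ k (zeros f) k (begin
    zeros f + k     ≡⟨ cong (zeros f +_) (sym (proj₁ (proj₂ dw))) ⟩
    zeros f + ones f ≡⟨ zeros+ones≡length f ⟩
    length f        ≡⟨ proj₁ dw ⟩
    2 * k           ≡⟨ cong (k +_) (+-identityʳ k) ⟩
    k + k           ∎)
    where open ≡-Reasoning

  DyckWord⇒endHeight≡0 : endHeight 0 f ≡ 0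
  DyckWord⇒endHeight≡0 = +-cancelʳ-≡ k (endHeight 0 f) 0 (begin
    endHeight 0 f + k      ≡⟨ cong (endHeight 0 f +_) (sym (proj₁ (proj₂ dw))) ⟩
    endHeight 0 f + ones f ≡⟨ endHeight+ones 0 f DyckWord⇒NonNeg ⟩
    zeros f                ≡⟨ DyckWord⇒zeros≡k ⟩
    k                      ∎)
    where open ≡-Reasoning

DyckWord⇒maxHeight>0 : ∀ {k f} → 1 ≤ k → DyckWord k f → 0 < maxHeight 0 f
DyckWord⇒maxHeight>0 {suc k} {[]} _ (() , _)
DyckWord⇒maxHeight>0 {suc k} {false ∷ w} _ _ = start≤maxHeight 1 w
DyckWord⇒maxHeight>0 {suc k} {true ∷ w} _ dw = ⊥-elim (DyckWord⇒NonNeg dw)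

ups-downs-balance : ∀ h w y → NonNeg h w →
  ups y (layers h w) + 𝟙 (y <ᵇ h) ≡ downs y (layers h w) + 𝟙 (y <ᵇ endHeight h w)
ups-downs-balance h [] y nn = refl
ups-downs-balance h (false ∷ w) y nn = begin
  (𝟙 (y ≡ᵇ h) + ups y L) + 𝟙 (y <ᵇ h) ≡⟨ rearrange (𝟙 (y ≡ᵇ h)) (ups y L) _ ⟩
  ups y L + (𝟙 (y <ᵇ h) + 𝟙 (y ≡ᵇ h)) ≡⟨ cong (ups y L +_) (𝟙-<ᵇ-suc y h) ⟨
  ups y L + 𝟙 (y <ᵇ suc h)            ≡⟨ ups-downs-balance (suc h) w y nn ⟩
  downs y L + 𝟙 (y <ᵇ endHeight (suc h) w) ∎
  where
  open ≡-Reasoning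
  L = layers (suc h) w
  rearrange : ∀ e u l → (e + u) + l ≡ u + (l + e)
  rearrange = solve-∀
ups-downs-balance (suc h) (true ∷ w) y nn = begin
  ups y L + 𝟙 (y <ᵇ suc h)               ≡⟨ cong (ups y L +_) (𝟙-<ᵇ-suc y h) ⟩
  ups y L + (𝟙 (y <ᵇ h) + 𝟙 (y ≡ᵇ h))    ≡⟨ sym (+-assoc (ups y L) _ _) ⟩
  (ups y L + 𝟙 (y <ᵇ h)) + 𝟙 (y ≡ᵇ h)
    ≡⟨ cong (_+ 𝟙 (y ≡ᵇ h)) (ups-downs-balance h w y nn) ⟩
  (downs y L + 𝟙 (y <ᵇ endHeight h w)) + 𝟙 (y ≡ᵇ h)
    ≡⟨ rearrange (downs y L) (𝟙 (y <ᵇ endHeight h w)) (𝟙 (y ≡ᵇ h)) ⟩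
  (𝟙 (y ≡ᵇ h) + downs y L) + 𝟙 (y <ᵇ endHeight h w) ∎
  where
  open ≡-Reasoning
  L = layers h w
  rearrange : ∀ d l e → (d + l) + e ≡ (e + d) + l
  rearrange = solve-∀

DyckWord⇒downs≡ups : ∀ {k f} → DyckWord k f → ∀ y → downs y (layers 0 f) ≡ ups y (layers 0 f)
DyckWord⇒downs≡ups {f = f} dw y = sym (+-cancelʳ-≡ 0 _ _
  (subst (λ e → ups y L + 0 ≡ downs y L + 𝟙 (y <ᵇ e)) (DyckWord⇒endHeight≡0 dw)
    (ups-downs-balance 0 f y (DyckWord⇒NonNeg dw))))
  where L = layers 0 f

countBelow-layers : ∀ h w y → LayersBelow y (layers h w) → countBelow y (layers h w) ≡ zeros w
countBelow-layers h [] y _ = refl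
countBelow-layers h (false ∷ w) y (h<y ∷ L<y)
  rewrite <⇒<ᵇ-true h<y = cong suc (countBelow-layers (suc h) w y L<y)
countBelow-layers h (true ∷ w) y (_ ∷ L<y) = countBelow-layers (h ∸ 1) w y L<y

labelsBefore : List Step → List Step → List Step → List ℕ
labelsBefore all [] B = []
labelsBefore all ((b , y) ∷ A) B =
  (countBelow y all + countSame (b , y) (A ++ B) + 1) ∷ labelsBefore all A B

labels-++ : ∀ all A B → labels all (A ++ B) ≡ labelsBefore all A B ++ labels all B
labels-++ all [] B = refl
labels-++ all ((b , y) ∷ A) B =
  cong ((countBelow y all + countSame (b , y) (A ++ B) + 1) ∷_) (labels-++ all A B)

labels≡labelsBefore-[] : ∀ all L → labels all L ≡ labelsBefore all L []
labels≡labelsBefore-[] all L = begin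
  labels all L                          ≡⟨ cong (labels all) (sym (++-identityʳ L)) ⟩
  labels all (L ++ [])                  ≡⟨ labels-++ all L [] ⟩
  labelsBefore all L [] ++ []           ≡⟨ ++-identityʳ _ ⟩
  labelsBefore all L []                 ∎
  where open ≡-Reasoning

labelsBefore-cong : ∀ all₁ all₂ A B₁ B₂ H → LayersBelow H A →
  (∀ y → y < H → countBelow y all₁ ≡ countBelow y all₂) →
  (∀ b y → y < H → countSame (b , y) B₁ ≡ countSame (b , y) B₂) →
  labelsBefore all₁ A B₁ ≡ labelsBefore all₂ A B₂
labelsBefore-cong all₁ all₂ [] B₁ B₂ H _ _ _ = refl
labelsBefore-cong all₁ all₂ ((b , y) ∷ A) B₁ B₂ H (y<H ∷ A<H) below same =
  cong₂ _∷_ (cong₂ (λ s t → s + t + 1) (below y y<H) suffix)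
            (labelsBefore-cong all₁ all₂ A B₁ B₂ H A<H below same)
  where
  open ≡-Reasoning
  suffix : countSame (b , y) (A ++ B₁) ≡ countSame (b , y) (A ++ B₂)
  suffix = begin
    countSame (b , y) (A ++ B₁)               ≡⟨ countSame-++ (b , y) A B₁ ⟩
    countSame (b , y) A + countSame (b , y) B₁ ≡⟨ cong (countSame (b , y) A +_) (same b y y<H) ⟩
    countSame (b , y) A + countSame (b , y) B₂ ≡⟨ countSame-++ (b , y) A B₂ ⟨
    countSame (b , y) (A ++ B₂)               ∎

labels-cong : ∀ all₁ all₂ L H → LayersBelow H L →
  (∀ y → y < H → countBelow y all₁ ≡ countBelow y all₂) → labels all₁ L ≡ labels all₂ L
labels-cong all₁ all₂ [] H _ _ = refl
labels-cong all₁ all₂ ((b , y) ∷ L) H (y<H ∷ L<H) below =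
  cong₂ _∷_ (cong (λ s → s + countSame (b , y) L + 1) (below y y<H))
            (labels-cong all₁ all₂ L H L<H below)

labelsBefore-< : ∀ all A B T K → (∀ s → countSame s (A ++ B) ≤ countSame s T) →
  All (λ s → countBelow (proj₂ s) all + countSame s T < K) A → All (_< K) (labelsBefore all A B)
labelsBefore-< all [] B T K _ _ = []
labelsBefore-< all ((b , y) ∷ A) B T K ≤T (bound ∷ bounds) =
  ≤-<-trans head≤ bound ∷
  labelsBefore-< all A B T K (λ s → ≤-trans (countSame-≤-∷ s (b , y) (A ++ B)) (≤T s)) bounds
  where
  open ≤-Reasoning
  a = countBelow y all
  head≤ : a + countSame (b , y) (A ++ B) + 1 ≤ a + countSame (b , y) T
  head≤ = begin
    a + countSame (b , y) (A ++ B) + 1       ≡⟨ +-assoc a _ 1 ⟩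
    a + (countSame (b , y) (A ++ B) + 1)     ≡⟨ cong (a +_) (+-comm _ 1) ⟩
    a + suc (countSame (b , y) (A ++ B))     ≡⟨ cong (a +_) (countSame-here b y (A ++ B)) ⟨
    a + countSame (b , y) ((b , y) ∷ A ++ B) ≤⟨ +-monoʳ-≤ a (≤T (b , y)) ⟩
    a + countSame (b , y) T                  ∎

labels-< : ∀ all L K → All (λ s → countBelow (proj₂ s) all + countSame s L < K) L →
  All (_< K) (labels all L)
labels-< all L K bounds = subst (All (_< K)) (sym (labels≡labelsBefore-[] all L))
  (labelsBefore-< all L [] L K (λ s → ≤-reflexive (cong (countSame s) (++-identityʳ L))) bounds)

All<⇒∉ : ∀ {k} xs → All (_< k) xs → k ∉ xs
All<⇒∉ (x ∷ xs) (x<k ∷ _) (here refl) = <-irrefl refl x<k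
All<⇒∉ (x ∷ xs) (_ ∷ xs<k) (there k∈xs) = All<⇒∉ xs xs<k k∈xs

elemᵇ-here : ∀ x xs → elemᵇ x (x ∷ xs) ≡ true
elemᵇ-here x xs rewrite ≡ᵇ-refl x = refl

elemᵇ-there : ∀ x y xs → elemᵇ x xs ≡ true → elemᵇ x (y ∷ xs) ≡ true
elemᵇ-there x y xs x∈xs = trans (cong ((x ≡ᵇ y) ∨_) x∈xs) (∨-zeroʳ _)

module Decoding (Lf : List Step) (balanced : ∀ y → downs y Lf ≡ ups y Lf) where

  start size : ℕ → ℕ
  start y = countBelow y Lf
  size y = ups y Lf

  -- The up-steps of layer y carry the labels start y + 1, …, start y + size y from right to
  -- left, so the one with j up-steps of its layer to its left carries start y + size y − j.
  IsUpLabel : List Step → ℕ → Set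
  IsUpLabel read x = ∃[ y ] ∃[ j ] (j < ups y read × x + j ≡ start y + size y)

  label>start : ∀ {x j y} → x + j ≡ start y + size y → j < size y → start y < x
  label>start e j<size = ≰⇒> (λ x≤start → <-irrefl e (+-mono-≤-< x≤start j<size))

  label≤start-suc : ∀ {x j y} → x + j ≡ start y + size y → x ≤ start (suc y)
  label≤start-suc {x} {j} {y} e = subst (x ≤_) (trans e (sym (countBelow-suc y Lf))) (m≤m+n x j)

  upLabel-layer-unique : ∀ {x j y j′ y′} → j < size y → x + j ≡ start y + size y →
    j′ < size y′ → x + j′ ≡ start y′ + size y′ → y ≡ y′
  upLabel-layer-unique {y = y} {y′ = y′} j< e j′< e′ with <-cmp y y′
  ... | tri< y<y′ _ _ = ⊥-elim (separated e j′< e′ y<y′)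
    where
    separated : ∀ {x j y j′ y′} → x + j ≡ start y + size y →
      j′ < size y′ → x + j′ ≡ start y′ + size y′ → ¬ y < y′
    separated e j′< e′ y<y′ =
      <⇒≱ (label>start e′ j′<) (≤-trans (label≤start-suc e) (countBelow-mono Lf y<y′))
  ... | tri≈ _ y≡y′ _ = y≡y′
  ... | tri> _ _ y′<y =
    ⊥-elim (<⇒≱ (label>start e j<) (≤-trans (label≤start-suc e′) (countBelow-mono Lf y′<y)))

  record Invariant (h : ℕ) (read : List Step) (R : List Bool) (seen : List ℕ) : Set where
    field
      counts : ∀ b y → countSame (b , y) Lf ≡ countSame (b , y) read + countSame (b , y) (layers h R)
      heights : ∀ y → ups y read ≡ downs y read + 𝟙 (y <ᵇ h)
      seen⇒upLabel : ∀ x → elemᵇ x seen ≡ true → IsUpLabel read x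
      upLabel⇒seen : ∀ x → IsUpLabel read x → elemᵇ x seen ≡ true

  counts-shift : ∀ s read L b y →
    countSame (b , y) Lf ≡ countSame (b , y) read + countSame (b , y) (s ∷ L) →
    countSame (b , y) Lf ≡ countSame (b , y) (s ∷ read) + countSame (b , y) L
  counts-shift (c , z) read L b y e =
    trans e (rearrange (countSame (b , y) read) (𝟙 (beq b c ∧ (y ≡ᵇ z))) (countSame (b , y) L))
    where
    rearrange : ∀ r e l → r + (e + l) ≡ (e + r) + l
    rearrange = solve-∀

  rank : ∀ a r u → a + r + 1 + u ≡ a + (u + suc r)
  rank = solve-∀

  module UpStep {h read R seen} (inv : Invariant h read (false ∷ R) seen) where
    open Invariant inv

    right done ℓ : ℕ
    right = ups h (layers (suc h) R)
    done = ups h read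
    ℓ = start h + right + 1

    size-h : size h ≡ done + suc right
    size-h = trans (counts false h) (cong (done +_) (countSame-here false h (layers (suc h) R)))

    ℓ-rank : ℓ + done ≡ start h + size h
    ℓ-rank = trans (rank (start h) right done) (cong (start h +_) (sym size-h))

    done<size : done < size h
    done<size = subst (done <_) (sym size-h) (m<m+n done z<s)

    ups-read≤size : ∀ y → ups y read ≤ size y
    ups-read≤size y = subst (ups y read ≤_) (sym (counts false y)) (m≤m+n _ _)

    fresh : elemᵇ ℓ seen ≡ false
    fresh with elemᵇ ℓ seen in ℓ∈seen
    ... | false = refl
    ... | true with seen⇒upLabel ℓ ℓ∈seen
    ... | y , j , j< , e with upLabel-layer-unique done<size ℓ-rank (<-≤-trans j< (ups-read≤size y)) e
    ... | refl = ⊥-elim (<-irrefl (+-cancelˡ-≡ ℓ j done (trans e (sym ℓ-rank))) j<)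

    heights′ : ∀ y → ups y ((false , h) ∷ read) ≡ downs y ((false , h) ∷ read) + 𝟙 (y <ᵇ suc h)
    heights′ y rewrite 𝟙-<ᵇ-suc y h | heights y =
      rearrange (𝟙 (y ≡ᵇ h)) (downs y read) (𝟙 (y <ᵇ h))
      where
      rearrange : ∀ e d l → e + (d + l) ≡ d + (l + e)
      rearrange = solve-∀

    seen⇒upLabel′ : ∀ x → elemᵇ x (ℓ ∷ seen) ≡ true → IsUpLabel ((false , h) ∷ read) x
    seen⇒upLabel′ x x∈ with x ≡ᵇ ℓ in x≡ᵇℓ
    ... | true rewrite ≡ᵇ-true⇒≡ x ℓ x≡ᵇℓ =
      h , done , subst (done <_) (sym (countSame-here false h read)) ≤-refl , ℓ-rank
    ... | false with seen⇒upLabel x x∈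
    ... | y , j , j< , e = y , j , <-≤-trans j< (countSame-≤-∷ (false , y) (false , h) read) , e

    upLabel⇒seen′ : ∀ x → IsUpLabel ((false , h) ∷ read) x → elemᵇ x (ℓ ∷ seen) ≡ true
    upLabel⇒seen′ x (y , j , j< , e) with y ≟ h
    ... | no y≢h = elemᵇ-there x ℓ seen
      (upLabel⇒seen x (y , j , subst (j <_) (countSame-otherLayer false y false h read y≢h) j< , e))
    ... | yes refl with m<1+n⇒m<n∨m≡n (subst (j <_) (countSame-here false h read) j<)
    ... | inj₁ j<done = elemᵇ-there x ℓ seen (upLabel⇒seen x (y , j , j<done , e))
    ... | inj₂ refl = subst (λ z → elemᵇ z (ℓ ∷ seen) ≡ true)
      (sym (+-cancelʳ-≡ done x ℓ (trans e (sym ℓ-rank)))) (elemᵇ-here ℓ seen)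

    next : Invariant (suc h) ((false , h) ∷ read) R (ℓ ∷ seen)
    next = record
      { counts = λ b y → counts-shift (false , h) read (layers (suc h) R) b y (counts b y)
      ; heights = heights′
      ; seen⇒upLabel = seen⇒upLabel′
      ; upLabel⇒seen = upLabel⇒seen′
      }

  module DownStep {h read R seen} (inv : Invariant (suc h) read (true ∷ R) seen) where
    open Invariant inv

    right done ℓ : ℕ
    right = downs h (layers h R)
    done = downs h read
    ℓ = start h + right + 1

    ups-read : ups h read ≡ suc done
    ups-read = trans (heights h)
      (trans (cong (λ b → done + 𝟙 b) (<⇒<ᵇ-true (n<1+n h))) (+-comm done 1))

    size-h : size h ≡ done + suc right
    size-h = trans (sym (balanced h))
      (trans (counts true h) (cong (done +_) (countSame-here true h (layers h R))))

    matched : IsUpLabel read ℓ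
    matched = h , done , subst (done <_) (sym ups-read) ≤-refl ,
      trans (rank (start h) right done) (cong (start h +_) (sym size-h))

    repeated : elemᵇ ℓ seen ≡ true
    repeated = upLabel⇒seen ℓ matched

    heights′ : ∀ y → ups y ((true , h) ∷ read) ≡ downs y ((true , h) ∷ read) + 𝟙 (y <ᵇ h)
    heights′ y rewrite heights y | 𝟙-<ᵇ-suc y h =
      rearrange (downs y read) (𝟙 (y <ᵇ h)) (𝟙 (y ≡ᵇ h))
      where
      rearrange : ∀ d l e → d + (l + e) ≡ (e + d) + l
      rearrange = solve-∀

    seen⇒upLabel′ : ∀ x → elemᵇ x (ℓ ∷ seen) ≡ true → IsUpLabel ((true , h) ∷ read) x
    seen⇒upLabel′ x x∈ with x ≡ᵇ ℓ in x≡ᵇℓ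
    ... | true rewrite ≡ᵇ-true⇒≡ x ℓ x≡ᵇℓ = matched
    ... | false = seen⇒upLabel x x∈

    next : Invariant h ((true , h) ∷ read) R (ℓ ∷ seen)
    next = record
      { counts = λ b y → counts-shift (true , h) read (layers h R) b y (counts b y)
      ; heights = heights′
      ; seen⇒upLabel = seen⇒upLabel′
      ; upLabel⇒seen = λ x → elemᵇ-there x ℓ seen ∘ upLabel⇒seen x
      }

  decode : ∀ R {h read seen} → NonNeg h R → Invariant h read R seen →
    toBitsAux seen (labels Lf (layers h R)) ≡ R
  decode [] _ _ = refl
  decode (false ∷ R) nn inv = cong₂ _∷_ fresh (decode R nn next)
    where open UpStep inv
  decode (true ∷ R) {suc h} nn inv = cong₂ _∷_ repeated (decode R nn next)
    where open DownStep inv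

toBits-nest : ∀ {k f} → DyckWord k f → toBits (nest f) ≡ f
toBits-nest {f = f} dw = decode f (DyckWord⇒NonNeg dw) initial
  where
  open Decoding (layers 0 f) (DyckWord⇒downs≡ups dw)
  initial : Invariant 0 [] f []
  initial = record
    { counts = λ _ _ → refl
    ; heights = λ _ → refl
    ; seen⇒upLabel = λ _ ()
    ; upLabel⇒seen = λ { _ (_ , _ , () , _) }
    }

withPeak raisedPeak : List Bool → List Bool → List Bool
withPeak P Q = P ++ false ∷ true ∷ Q
raisedPeak P Q = P ++ false ∷ false ∷ true ∷ true ∷ Q

length-raise : ∀ P Q → length (raisedPeak P Q) ≡ 2 + length (withPeak P Q)
length-raise [] Q = refl
length-raise (_ ∷ P) Q = cong suc (length-raise P Q)

ones-raise : ∀ P Q → ones (raisedPeak P Q) ≡ suc (ones (withPeak P Q))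
ones-raise [] Q = refl
ones-raise (false ∷ P) Q = ones-raise P Q
ones-raise (true ∷ P) Q = cong suc (ones-raise P Q)

NonNeg-raise : ∀ h P Q → NonNeg h (withPeak P Q) → NonNeg h (raisedPeak P Q)
NonNeg-raise h [] Q nn = nn
NonNeg-raise h (false ∷ P) Q nn = NonNeg-raise (suc h) P Q nn
NonNeg-raise (suc h) (true ∷ P) Q nn = NonNeg-raise h P Q nn

DyckWord-raise : ∀ {k} P Q → DyckWord k (withPeak P Q) →
  DyckWord (suc k) (raisedPeak P Q)
DyckWord-raise {k} P Q dw@(len , ones≡k , _) =
  trans (length-raise P Q) (trans (cong (2 +_) len) (sym (*-distribˡ-+ 2 1 k))) ,
  trans (ones-raise P Q) (cong suc ones≡k) ,
  λ n → subst (ones (take n g) ≤_) (+-identityʳ _)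
    (NonNeg⇒PrefixBalanced 0 g (NonNeg-raise 0 P Q (DyckWord⇒NonNeg dw)) n)
  where g = raisedPeak P Q

firstHighestPeak : ∀ h w M → NonNeg h w → maxHeight h w ≡ M → h < M → endHeight h w < M →
  ∃[ P ] ∃[ Q ] (w ≡ withPeak P Q × suc (endHeight h P) ≡ M × maxHeight h P < M)
firstHighestPeak h [] M nn max≡M h<M _ = ⊥-elim (<-irrefl max≡M h<M)
firstHighestPeak h (false ∷ w) M nn max≡M h<M end<M with suc h ≟ M
firstHighestPeak h (false ∷ []) M nn max≡M h<M end<M | yes 1+h≡M = ⊥-elim (<-irrefl 1+h≡M end<M)
firstHighestPeak h (false ∷ false ∷ w) M nn max≡M h<M end<M | yes 1+h≡M =
  ⊥-elim (<-irrefl refl (begin-strict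
    M                              ≡⟨ 1+h≡M ⟨
    suc h                          <⟨ start≤maxHeight (suc (suc h)) w ⟩
    maxHeight (suc (suc h)) w      ≡⟨ max≡M ⟩
    M                              ∎))
  where open ≤-Reasoning
firstHighestPeak h (false ∷ true ∷ Q) M nn max≡M h<M end<M | yes 1+h≡M = [] , Q , refl , 1+h≡M , h<M
firstHighestPeak h (false ∷ w) M nn max≡M h<M end<M | no 1+h≢M
  with firstHighestPeak (suc h) w M nn max≡M (≤∧≢⇒< h<M 1+h≢M) end<M
... | P , Q , w≡ , top , below = false ∷ P , Q , cong (false ∷_) w≡ , top , below
firstHighestPeak (suc h) (true ∷ w) M nn max≡M h<M end<M
  with firstHighestPeak h w M nn tail-max≡M (<-trans (n<1+n h) h<M) end<M
  where
  tail-max≡M : maxHeight h w ≡ M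
  tail-max≡M with ≤-total (suc h) (maxHeight h w)
  ... | inj₁ 1+h≤ = trans (sym (m≤n⇒m⊔n≡n 1+h≤)) max≡M
  ... | inj₂ ≤1+h = ⊥-elim (<-irrefl (trans (sym (m≥n⇒m⊔n≡m ≤1+h)) max≡M) h<M)
... | P , Q , w≡ , top , below = true ∷ P , Q , cong (true ∷_) w≡ , top , ⊔-lub h<M below

module HighestPeak (k : ℕ) (P Q : List Bool) (dw : DyckWord k (withPeak P Q))
  (f-max : maxHeight 0 (withPeak P Q) ≡ suc (endHeight 0 P))
  (P-max : maxHeight 0 P < suc (endHeight 0 P)) where

  f g : List Bool
  f = withPeak P Q
  g = raisedPeak P Q

  t : ℕ
  t = endHeight 0 P

  LP LQ Rf Rg Lf Lg : List Step
  LP = layers 0 P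
  LQ = layers t Q
  Rf = (false , t) ∷ (true , t) ∷ LQ
  Rg = (false , t) ∷ (false , suc t) ∷ (true , suc t) ∷ (true , t) ∷ LQ
  Lf = LP ++ Rf
  Lg = LP ++ Rg

  layers-f : layers 0 f ≡ Lf
  layers-f = layers-++ 0 P (false ∷ true ∷ Q)

  layers-g : layers 0 g ≡ Lg
  layers-g = layers-++ 0 P (false ∷ false ∷ true ∷ true ∷ Q)

  f-nonneg : NonNeg 0 f
  f-nonneg = DyckWord⇒NonNeg dw

  LP-below : LayersBelow t LP
  LP-below = layers-below 0 P t (proj₁ (NonNeg-++⁻ 0 P _ f-nonneg)) (≤-pred P-max)

  LQ-below : LayersBelow (suc t) LQ
  LQ-below = layers-below t Q (suc t) (proj₂ (NonNeg-++⁻ 0 P _ f-nonneg))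
    (≤-trans (m≤n⊔m (suc t) (maxHeight t Q))
      (≤-trans (maxHeight-suffix 0 P (false ∷ true ∷ Q)) (≤-reflexive f-max)))

  c : ℕ → ℕ
  c y = countBelow y Lf

  c-top≡k : c (suc t) ≡ k
  c-top≡k = begin
    countBelow (suc t) Lf          ≡⟨ cong (countBelow (suc t)) layers-f ⟨
    countBelow (suc t) (layers 0 f)
      ≡⟨ countBelow-layers 0 f (suc t) (layers-below 0 f (suc t) f-nonneg (≤-reflexive f-max)) ⟩
    zeros f                        ≡⟨ DyckWord⇒zeros≡k dw ⟩
    k                              ∎
    where open ≡-Reasoning

  balanced : ∀ y → downs y Lf ≡ ups y Lf
  balanced y = subst (λ L → downs y L ≡ ups y L) layers-f (DyckWord⇒downs≡ups dw y)

  ups-top : ups t Lf ≡ suc (ups t LQ)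
  ups-top = trans (countSame-++ (false , t) LP Rf)
    (cong₂ _+_ (countSame-aboveAll false t LP LP-below) (countSame-here false t ((true , t) ∷ LQ)))

  downs-top : downs t Lf ≡ suc (downs t LQ)
  downs-top = trans (countSame-++ (true , t) LP Rf)
    (cong₂ _+_ (countSame-aboveAll true t LP LP-below) (countSame-here true t LQ))

  top-balanced : downs t LQ ≡ ups t LQ
  top-balanced = suc-injective (trans (sym downs-top) (trans (balanced t) ups-top))

  k≡ : k ≡ c t + suc (ups t LQ)
  k≡ = trans (sym c-top≡k) (trans (countBelow-suc t Lf) (cong (c t +_) ups-top))

  peak-up-label : c t + ups t LQ + 1 ≡ k
  peak-up-label = trans (+-assoc (c t) (ups t LQ) 1) (trans (cong (c t +_) (+-comm (ups t LQ) 1)) (sym k≡))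

  peak-down-label : c t + downs t LQ + 1 ≡ k
  peak-down-label = trans (cong (λ n → c t + n + 1) top-balanced) peak-up-label

  u v : List ℕ
  u = labelsBefore Lf LP Rf
  v = labels Lf LQ

  nest-f : nest f ≡ u ++ k ∷ k ∷ v
  nest-f = begin
    nest f            ≡⟨ cong₂ labels layers-f layers-f ⟩
    labels Lf Lf      ≡⟨ labels-++ Lf LP Rf ⟩
    u ++ labels Lf Rf ≡⟨ cong (u ++_) (cong₂ _∷_ peak-up-label (cong₂ _∷_ peak-down-label refl)) ⟩
    u ++ k ∷ k ∷ v    ∎
    where open ≡-Reasoning

  label<k-belowTop : ∀ b y → y < t → c y + countSame (b , y) Lf < k
  label<k-belowTop b y y<t = begin-strict
    c y + countSame (b , y) Lf ≡⟨ cong (c y +_) (same≡ups b) ⟩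
    c y + ups y Lf             ≡⟨ countBelow-suc y Lf ⟨
    c (suc y)                  ≤⟨ countBelow-mono Lf y<t ⟩
    c t                        <⟨ m<m+n (c t) z<s ⟩
    c t + suc (ups t LQ)       ≡⟨ k≡ ⟨
    k                          ∎
    where
    open ≤-Reasoning
    same≡ups : ∀ b → countSame (b , y) Lf ≡ ups y Lf
    same≡ups false = refl
    same≡ups true = balanced y

  k∉u : k ∉ u
  k∉u = All<⇒∉ u (labelsBefore-< Lf LP Rf Lf k (λ _ → ≤-refl)
    (All.map (λ {(b , y)} → label<k-belowTop b y) LP-below))

  LQ≤Lf : ∀ s → countSame s LQ ≤ countSame s Lf
  LQ≤Lf s = ≤-trans (countSame-≤-∷ s (true , t) LQ)
    (≤-trans (countSame-≤-∷ s (false , t) ((true , t) ∷ LQ)) (countSame-suffix s LP Rf))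

  label<k-afterPeak : ∀ b y → y < suc t → c y + countSame (b , y) LQ < k
  label<k-afterPeak b y y<1+t with m<1+n⇒m<n∨m≡n y<1+t
  ... | inj₁ y<t = ≤-<-trans (+-monoʳ-≤ (c y) (LQ≤Lf (b , y))) (label<k-belowTop b y y<t)
  ... | inj₂ refl =
    subst (c t + countSame (b , t) LQ <_) (sym k≡) (+-monoʳ-< (c t) (s≤s (≤-reflexive (same≡ups b))))
    where
    same≡ups : ∀ b → countSame (b , t) LQ ≡ ups t LQ
    same≡ups false = refl
    same≡ups true = top-balanced

  k∉v : k ∉ v
  k∉v = All<⇒∉ v (labels-< Lf LQ k (All.map (λ {(b , y)} → label<k-afterPeak b y) LQ-below))

  countBelow-g≡f : ∀ y → y ≤ suc t → countBelow y Lg ≡ countBelow y Lf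
  countBelow-g≡f y y≤1+t rewrite countBelow-++ y LP Rg | countBelow-++ y LP Rf
    | ≮⇒<ᵇ-false (suc t) y (≤⇒≯ y≤1+t) = refl

  countSame-Rg≡Rf : ∀ b y → y < suc t → countSame (b , y) Rg ≡ countSame (b , y) Rf
  countSame-Rg≡Rf b y y<1+t = cong (𝟙 (beq b false ∧ (y ≡ᵇ t)) +_)
    (trans (countSame-otherLayer b y false (suc t) ((true , suc t) ∷ (true , t) ∷ LQ) (<⇒≢ y<1+t))
           (countSame-otherLayer b y true (suc t) ((true , t) ∷ LQ) (<⇒≢ y<1+t)))

  labels-Rg : labels Lg Rg ≡ k ∷ suc k ∷ suc k ∷ k ∷ labels Lg LQ
  labels-Rg = cong₂ _∷_ up-t (cong₂ _∷_ up-top (cong₂ _∷_ down-top (cong₂ _∷_ down-t refl)))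
    where
    t≢1+t : t ≢ suc t
    t≢1+t = <⇒≢ (n<1+n t)
    c-g : ∀ y → y ≤ suc t → countBelow y Lg ≡ c y
    c-g = countBelow-g≡f
    k+0+1 : k + 0 + 1 ≡ suc k
    k+0+1 = trans (cong (_+ 1) (+-identityʳ k)) (+-comm k 1)
    up-t : countBelow t Lg + countSame (false , t) ((false , suc t) ∷ (true , suc t) ∷ (true , t) ∷ LQ) + 1 ≡ k
    up-t = trans (cong₂ (λ a b → a + b + 1) (c-g t (n≤1+n t))
      (trans (countSame-otherLayer false t false (suc t) ((true , suc t) ∷ (true , t) ∷ LQ) t≢1+t)
             (countSame-otherLayer false t true (suc t) ((true , t) ∷ LQ) t≢1+t)))
      peak-up-label
    up-top : countBelow (suc t) Lg + countSame (false , suc t) ((true , suc t) ∷ (true , t) ∷ LQ) + 1 ≡ suc k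
    up-top = trans (cong₂ (λ a b → a + b + 1) (trans (c-g (suc t) ≤-refl) c-top≡k)
      (countSame-aboveAll false (suc t) LQ LQ-below)) k+0+1
    down-top : countBelow (suc t) Lg + countSame (true , suc t) ((true , t) ∷ LQ) + 1 ≡ suc k
    down-top = trans (cong₂ (λ a b → a + b + 1) (trans (c-g (suc t) ≤-refl) c-top≡k)
      (trans (countSame-otherLayer true (suc t) true t LQ (t≢1+t ∘ sym))
             (countSame-aboveAll true (suc t) LQ LQ-below)))
      k+0+1
    down-t : countBelow t Lg + countSame (true , t) LQ + 1 ≡ k
    down-t = trans (cong (λ a → a + downs t LQ + 1) (c-g t (n≤1+n t))) peak-down-label

  nest-g : nest g ≡ u ++ k ∷ suc k ∷ suc k ∷ k ∷ v
  nest-g = begin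
    nest g                                     ≡⟨ cong₂ labels layers-g layers-g ⟩
    labels Lg Lg                               ≡⟨ labels-++ Lg LP Rg ⟩
    labelsBefore Lg LP Rg ++ labels Lg Rg      ≡⟨ cong₂ _++_ prefix-unchanged labels-Rg ⟩
    u ++ k ∷ suc k ∷ suc k ∷ k ∷ labels Lg LQ
      ≡⟨ cong (λ w → u ++ k ∷ suc k ∷ suc k ∷ k ∷ w) suffix-unchanged ⟩
    u ++ k ∷ suc k ∷ suc k ∷ k ∷ v             ∎
    where
    open ≡-Reasoning
    below-unchanged : ∀ y → y < suc t → countBelow y Lg ≡ countBelow y Lf
    below-unchanged y = countBelow-g≡f y ∘ <⇒≤
    prefix-unchanged : labelsBefore Lg LP Rg ≡ u
    prefix-unchanged = labelsBefore-cong Lg Lf LP Rg Rf (suc t)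
      (All.map (λ y<t → <-trans y<t (n<1+n t)) LP-below) below-unchanged countSame-Rg≡Rf
    suffix-unchanged : labels Lg LQ ≡ v
    suffix-unchanged = labels-cong Lg Lf LQ (suc t) LQ-below below-unchanged

  g-DyckWord : DyckWord (suc k) g
  g-DyckWord = DyckWord-raise P Q dw

lemma22 : (k : ℕ) → 1 ≤ k → (f : List Bool) → DyckWord k f →
    ∃[ u ] ∃[ v ] ((nest f ≡ u ++ k ∷ k ∷ v) × k ∉ u × k ∉ v
    × IsDyckNest (suc k) (u ++ k ∷ suc k ∷ suc k ∷ k ∷ v)
    × DyckWord (suc k) (toBits (u ++ k ∷ suc k ∷ suc k ∷ k ∷ v)))
lemma22 k 1≤k f dw
  with firstHighestPeak 0 f (maxHeight 0 f) (DyckWord⇒NonNeg dw) refl max>0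
         (subst (_< maxHeight 0 f) (sym (DyckWord⇒endHeight≡0 dw)) max>0)
  where
  max>0 : 0 < maxHeight 0 f
  max>0 = DyckWord⇒maxHeight>0 1≤k dw
... | P , Q , refl , top , below =
  u , v , nest-f , k∉u , k∉v , (g , g-DyckWord , nest-g) ,
  subst (DyckWord (suc k) ∘ toBits) nest-g
    (subst (DyckWord (suc k)) (sym (toBits-nest g-DyckWord)) g-DyckWord)
  where open HighestPeak k P Q dw (sym top) (subst (maxHeight 0 P <_) (sym top) below)
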